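{- Let $n,k,s,t,i$ be positive integers with $t\ge 3$, $(t+1)(k-t+1)\le n$, $t+3\le s\le 2k-t$ and $\max\{t+1,\,s+t-k\}\le i\le \min\{k,\frac{s+t}{2}\}$. Define \[ S_2=s(n-s+1)-(s+t-i)(k+i-s-t),\qquad T_1=i(n-k-s+i+1)+(s-i)(k-i+1), \] \[ T_2=(s+t-i)(n-k-i+t+1)+(i-t)(k-s-t+i+1). \] Then $S_2>T_1+s(k+i-s-t+1)-(S_2-T_2)$. -}

module Defs where

open import Data.Nat using (ℕ)
open import Data.Integer using (ℤ; +_; _+_; _-_; _*_)

-- The quantities of Lemma 3.5, computed in ℤ (with n,k,s,t,i : ℕ cast via +_)
-- so that subtraction is genuine integer subtraction.

S₂ : ℕ → ℕ → ℕ → ℕ → ℕ → ℤ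
S₂ n k s t i = (+ s) * ((+ n) - (+ s) + + 1)
             - ((+ s) + (+ t) - (+ i)) * ((+ k) + (+ i) - (+ s) - (+ t))

T₁ : ℕ → ℕ → ℕ → ℕ → ℕ → ℤ
T₁ n k s t i = (+ i) * ((+ n) - (+ k) - (+ s) + (+ i) + + 1)
             + ((+ s) - (+ i)) * ((+ k) - (+ i) + + 1)

T₂ : ℕ → ℕ → ℕ → ℕ → ℕ → ℤ
T₂ n k s t i = ((+ s) + (+ t) - (+ i)) * ((+ n) - (+ k) - (+ i) + (+ t) + + 1)
             + ((+ i) - (+ t)) * ((+ k) - (+ s) - (+ t) + (+ i) + + 1)

{-# OPTIONS --safe #-}
module Submission where

-- Put p = i − t − 1, w = s + t − 2i and r = k + i − s − t; by the hypotheses these are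
-- non-negative, and so are t − 3, s − t and n − (t + 1)(k − t + 1). Expanding, the
-- difference S₂ − (T₁ + s(k + i − s − t + 1) − (S₂ − T₂)) equals
--   (t − 2)(s − t − 1)(k − t) + (n − (t + 1)(k − t + 1))(s − t)
--     + (t − 3)(p + 2w) + p(2p + 5w + 2r + 5) + w(w + 9),
-- where s − t − 1 = 1 + 2p + w and k − t = 1 + p + w + r. Every summand is non-negative
-- and the first is at least 1.

open import Defs
open import Relation.Binary.PropositionalEquality using (_≡_; refl; sym; trans; cong; subst)

module Margin where
  open import Data.Nat using (z≤n; s≤s)
  open import Data.Integer
  import Data.Integer.Properties as ℤ
  open import Data.Integer.Tactic.RingSolver using (solve-∀)

  -- The solver does not unfold definitions, so S₂, T₁ and T₂ are spelled out; at
  -- + n, + k, + s, + t, + i both sides of lemma3p5 appear here up to unfolding.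
  margin-identity : ∀ n k s t i →
    let h = t - + 3 ; p = i - (t + + 1) ; w = s + t - + 2 * i ; r = k + i - (s + t) in
    s * (n - s + + 1) - (s + t - i) * (k + i - s - t)
      ≡ (i * (n - k - s + i + + 1) + (s - i) * (k - i + + 1) + s * (k + i - s - t + + 1))
        - (s * (n - s + + 1) - (s + t - i) * (k + i - s - t)
           - ((s + t - i) * (n - k - i + t + + 1) + (i - t) * (k - s - t + i + + 1)))
        + ((+ 1 + h) * (+ 1 + + 2 * p + w) * (+ 1 + p + w + r)
           + (n - (t + + 1) * (k + + 1 - t)) * (s - t)
           + h * (p + + 2 * w)
           + p * (+ 5 + + 2 * p + + 5 * w + + 2 * r)
           + w * (+ 9 + w))
  margin-identity = solve-∀

  0≤x+y : ∀ {x y} → 0ℤ ≤ x → 0ℤ ≤ y → 0ℤ ≤ x + y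
  0≤x+y = ℤ.+-mono-≤

  0<x+y : ∀ {x y} → 0ℤ < x → 0ℤ ≤ y → 0ℤ < x + y
  0<x+y = ℤ.+-mono-<-≤

  0≤x*y : ∀ {x y} → 0ℤ ≤ x → 0ℤ ≤ y → 0ℤ ≤ x * y
  0≤x*y {y = y} 0≤x 0≤y = ℤ.*-monoʳ-≤-nonNeg y {{nonNegative 0≤y}} 0≤x

  0<x*y : ∀ {x y} → 0ℤ < x → 0ℤ < y → 0ℤ < x * y
  0<x*y {y = y} 0<x 0<y = ℤ.*-monoʳ-<-pos y {{positive 0<y}} 0<x

  0≤+m*x : ∀ m {x} → 0ℤ ≤ x → 0ℤ ≤ + m * x
  0≤+m*x m = 0≤x*y (+≤+ (z≤n {m}))

  0<1+x : ∀ {x} → 0ℤ ≤ x → 0ℤ < + 1 + x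
  0<1+x = 0<x+y (+<+ (s≤s z≤n))

  margin-positive : ∀ {h a σ p w r} →
    0ℤ ≤ h → 0ℤ ≤ a → 0ℤ ≤ σ → 0ℤ ≤ p → 0ℤ ≤ w → 0ℤ ≤ r →
    0ℤ < (+ 1 + h) * (+ 1 + + 2 * p + w) * (+ 1 + p + w + r) + a * σ
           + h * (p + + 2 * w) + p * (+ 5 + + 2 * p + + 5 * w + + 2 * r) + w * (+ 9 + w)
  margin-positive {h} {_} {_} {p} {w} {r} h≥0 a≥0 σ≥0 p≥0 w≥0 r≥0 =
    0<x+y (0<x+y (0<x+y (0<x+y cube>0 (0≤x*y a≥0 σ≥0)) (0≤x*y h≥0 p+2w≥0)) (0≤x*y p≥0 5+2p+5w+2r≥0))
      (0≤x*y w≥0 (0≤x+y (+≤+ z≤n) w≥0))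
    where
    cube>0 : 0ℤ < (+ 1 + h) * (+ 1 + + 2 * p + w) * (+ 1 + p + w + r)
    cube>0 = 0<x*y (0<x*y (0<1+x h≥0) (0<x+y (0<1+x (0≤+m*x 2 p≥0)) w≥0))
                   (0<x+y (0<x+y (0<1+x p≥0) w≥0) r≥0)
    p+2w≥0 : 0ℤ ≤ p + + 2 * w
    p+2w≥0 = 0≤x+y p≥0 (0≤+m*x 2 w≥0)
    5+2p+5w+2r≥0 : 0ℤ ≤ + 5 + + 2 * p + + 5 * w + + 2 * r
    5+2p+5w+2r≥0 = 0≤x+y (0≤x+y (0≤x+y (+≤+ z≤n) (0≤+m*x 2 p≥0)) (0≤+m*x 5 w≥0)) (0≤+m*x 2 r≥0)

  y≡x+m⇒0<m⇒x<y : ∀ {x y m} → y ≡ x + m → 0ℤ < m → x < y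
  y≡x+m⇒0<m⇒x<y {x} refl 0<m = subst (_< x + _) (ℤ.+-identityʳ x) (ℤ.+-monoʳ-< x 0<m)

open import Data.Nat using (ℕ; _≤_; _+_; _*_; _∸_; _⊔_)
open import Data.Nat.Properties
  using (m⊔n≤o⇒m≤o; m⊔n≤o⇒n≤o; ≤-trans; m≤m+n; m≤n⇒m≤n+o; +-monoʳ-≤; m≤n+m∸n)
open import Data.Integer using (+_; +≤+; 0ℤ)
  renaming (_+_ to _+ℤ_; _-_ to _-ℤ_; _*_ to _*ℤ_; _<_ to _<ℤ_; _≤_ to _≤ℤ_)
import Data.Integer.Properties as ℤ
open Margin using (margin-identity; margin-positive; y≡x+m⇒0<m⇒x<y)

m∸n≤o⇒m≤n+o : ∀ m n {o} → m ∸ n ≤ o → m ≤ n + o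
m∸n≤o⇒m≤n+o m n m∸n≤o = ≤-trans (m≤n+m∸n m n) (+-monoʳ-≤ n m∸n≤o)

+[m∸n]≡+m-+n : ∀ {m n} → n ≤ m → + (m ∸ n) ≡ + m -ℤ + n
+[m∸n]≡+m-+n {m} {n} n≤m = sym (trans (ℤ.m-n≡m⊖n m n) (ℤ.⊖-≥ n≤m))

0≤+n-+m : ∀ {m n} → m ≤ n → 0ℤ ≤ℤ + n -ℤ + m
0≤+n-+m m≤n = ℤ.i≤j⇒0≤j-i (+≤+ m≤n)

lemma3p5 : (n k s t i : ℕ) → 1 ≤ n → 1 ≤ k → 1 ≤ s → 1 ≤ t → 1 ≤ i →
  3 ≤ t → (t + 1) * (k + 1 ∸ t) ≤ n → t + 3 ≤ s → s + t ≤ 2 * k →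
  (t + 1) ⊔ (s + t ∸ k) ≤ i → i ≤ k → 2 * i ≤ s + t →
  (T₁ n k s t i +ℤ (+ s) *ℤ ((+ k) +ℤ (+ i) -ℤ (+ s) -ℤ (+ t) +ℤ + 1)) -ℤ (S₂ n k s t i -ℤ T₂ n k s t i)
    <ℤ S₂ n k s t i
lemma3p5 n k s t i _ _ _ _ _ 3≤t n₀≤n t+3≤s _ ⊔≤i i≤k 2i≤s+t =
  y≡x+m⇒0<m⇒x<y (margin-identity (+ n) (+ k) (+ s) (+ t) (+ i))
    (margin-positive (0≤+n-+m 3≤t) 0≤n-n₀ (0≤+n-+m (≤-trans (m≤m+n t 3) t+3≤s))
      (0≤+n-+m t+1≤i) 0≤s+t-2i (0≤+n-+m s+t≤k+i))
  where
  t+1≤i : t + 1 ≤ i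
  t+1≤i = m⊔n≤o⇒m≤o (t + 1) (s + t ∸ k) ⊔≤i
  s+t≤k+i : s + t ≤ k + i
  s+t≤k+i = m∸n≤o⇒m≤n+o (s + t) k (m⊔n≤o⇒n≤o (t + 1) (s + t ∸ k) ⊔≤i)
  t≤k+1 : t ≤ k + 1
  t≤k+1 = m≤n⇒m≤n+o 1 (≤-trans (m≤m+n t 1) (≤-trans t+1≤i i≤k))
  0≤s+t-2i : 0ℤ ≤ℤ + s +ℤ + t -ℤ + 2 *ℤ + i
  0≤s+t-2i = subst (λ x → 0ℤ ≤ℤ + (s + t) -ℤ x) (ℤ.pos-* 2 i) (0≤+n-+m 2i≤s+t)
  0≤n-n₀ : 0ℤ ≤ℤ + n -ℤ (+ t +ℤ + 1) *ℤ (+ k +ℤ + 1 -ℤ + t)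
  0≤n-n₀ = ℤ.i≤j⇒0≤j-i (subst (_≤ℤ + n)
    (trans (ℤ.pos-* (t + 1) (k + 1 ∸ t)) (cong (+ (t + 1) *ℤ_) (+[m∸n]≡+m-+n t≤k+1))) (+≤+ n₀≤n))
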